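{- Let $\mathcal F$ be a family of non-empty subsets of a finite set $N$ covering $N$ that is closed under arbitrary unions, ordered by inclusion, and let $v$ be a capacity on $(\mathcal F,\subseteq)$ with extension $\hat v$. Then the following are equivalent: (i) $v$ is supermodular on $(\mathcal F,\subseteq)$; (ii) $\hat v:2^N\to\mathbb R$ is supermodular on $(2^N,\subseteq)$, i.e. $\hat v(S\cup T)+\hat v(S\cap T)\ge\hat v(S)+\hat v(T)$ for all $S,T\subseteq N$.
   Context: Index $\mathcal F=\{F_1,\dots,F_m\}$ so that $F_i\supseteq F_j$ implies $i\le j$. A capacity is $v:\mathcal F\to\mathbb R_+$ with $v(F)\le v(G)$ whenever $F\subseteq G$; set $v(\emptyset)=0$, $\mathcal F_0=\mathcal F\cup\{\emptyset\}$, $\mathcal F_0(X)=\{F\in\mathcal F_0\mid F\subseteq X\}$. $F_i,F_j$ are co-intersecting if there is $k\le\min\{i,j\}$ with $F_k\cap F_i\ne\emptyset$ and $F_k\cap F_j\ne\emptyset$. $v$ is supermodular on $(\mathcal F,\subseteq)$ if for all co-intersecting $F,G\in\mathcal F$ there exist $F\wedge G,F\vee G\in\mathcal F_0(F\cup G)$ with $F\wedge G\subseteq F,G\subseteq F\vee G$ and $v(F\wedge G)+v(F\vee G)\ge v(F)+v(G)$. For $F\in\mathcal F$, $\zeta^F(G)=1$ iff $G\supseteq F$, else $0$; $v$ has a unique expansion $v=\sum_F\beta_F\zeta^F$, and its extension is $\hat v(S)=\sum_{F\in\mathcal F,\,F\subseteq S}\beta_F$ for $S\subseteq N$.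
   Formalization: The capacity v, its expansion coefficients $\beta_F$ and the extension $\hat v$ take rational values rather than real ones. -}

module Defs where

open import Data.Nat using (ℕ; zero; suc)
open import Data.Bool using (true; false)
open import Data.Fin using (Fin; zero; suc; _≤_)
open import Data.Fin.Subset using (Subset; _⊆_; _∪_; _∩_; ⊥; Nonempty; _∈_)
open import Data.Fin.Subset.Properties using (_⊆?_)
open import Data.Maybe using (Maybe; just; nothing)
open import Data.Vec using (_∷_; [])
open import Data.Product using (Σ; ∃; _×_; _,_)
open import Data.Rational using (ℚ; 0ℚ; _+_) renaming (_≤_ to _≤ℚ_)
open import Relation.Nullary using (¬_; yes; no)
open import Relation.Binary.PropositionalEquality using (_≡_)
open import Function using (_∘_)

unionOver : ∀ {m n} → (Fin m → Subset n) → Subset m → Subset n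
unionOver {zero}  F []            = ⊥
unionOver {suc m} F (true ∷ I)  = F zero ∪ unionOver (F ∘ suc) I
unionOver {suc m} F (false ∷ I) = unionOver (F ∘ suc) I

sumFin : ∀ {m} → (Fin m → ℚ) → ℚ
sumFin {zero}  f = 0ℚ
sumFin {suc m} f = f zero + sumFin (f ∘ suc)

sumSub : ∀ {m n} → (Fin m → Subset n) → (Fin m → ℚ) → Subset n → ℚ
sumSub F β S = sumFin (λ j → sumTerm (F j ⊆? S) (β j))
  where
  sumTerm : ∀ {P : Set} → Relation.Nullary.Dec P → ℚ → ℚ
  sumTerm (yes _) q = q
  sumTerm (no _)  q = 0ℚ

record IsFamily {m n : ℕ} (F : Fin m → Subset n) : Set where
  field
    distinct  : ∀ i j → F i ≡ F j → i ≡ j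
    nonempty  : ∀ i → Nonempty (F i)
    covering  : ∀ (x : Fin n) → ∃ λ i → x ∈ F i
    unionClosed : ∀ (I : Subset m) → Nonempty I → ∃ λ k → F k ≡ unionOver F I
    indexing  : ∀ i j → F j ⊆ F i → i ≤ j

record IsCapacity {m n : ℕ} (F : Fin m → Subset n) (v : Fin m → ℚ) : Set where
  field
    nonneg   : ∀ i → 0ℚ ≤ℚ v i
    monotone : ∀ i j → F i ⊆ F j → v i ≤ℚ v j

-- ℱ₀ = ℱ ∪ {∅}, encoded as Maybe (Fin m) with nothing ↦ ∅
set₀ : ∀ {m n} → (Fin m → Subset n) → Maybe (Fin m) → Subset n
set₀ F nothing  = ⊥
set₀ F (just i) = F i

val₀ : ∀ {m} → (Fin m → ℚ) → Maybe (Fin m) → ℚ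
val₀ v nothing  = 0ℚ
val₀ v (just i) = v i

CoIntersecting : ∀ {m n} → (Fin m → Subset n) → Fin m → Fin m → Set
CoIntersecting F i j =
  ∃ λ k → k ≤ i × k ≤ j × Nonempty (F k ∩ F i) × Nonempty (F k ∩ F j)

SupermodularOn : ∀ {m n : ℕ} → (Fin m → Subset n) → (Fin m → ℚ) → Set
SupermodularOn {m} F v = ∀ i j → CoIntersecting F i j →
  Σ (Maybe (Fin m)) λ a → Σ (Maybe (Fin m)) λ b →
    set₀ F a ⊆ (F i ∪ F j) × set₀ F b ⊆ (F i ∪ F j) ×
    set₀ F a ⊆ F i × set₀ F a ⊆ F j × F i ⊆ set₀ F b × F j ⊆ set₀ F b ×
    (v i + v j) ≤ℚ (val₀ v a + val₀ v b)

-- β is the (unique) Möbius expansion coefficient vector: v = Σ_F β_F ζ^F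
IsExpansion : ∀ {m n} → (Fin m → Subset n) → (Fin m → ℚ) → (Fin m → ℚ) → Set
IsExpansion F v β = ∀ i → v i ≡ sumSub F β (F i)

extension : ∀ {m n} → (Fin m → Subset n) → (Fin m → ℚ) → Subset n → ℚ
extension = sumSub

SupermodularPowerset : ∀ {n} → (Subset n → ℚ) → Set
SupermodularPowerset {n} w = ∀ (S T : Subset n) → (w S + w T) ≤ℚ (w (S ∪ T) + w (S ∩ T))

{-# OPTIONS --safe #-}
module Submission where

-- For S ⊆ N let the interior S° be the union of all members of ℱ contained in S; as ℱ is closed
-- under unions, S° is the largest member of ℱ₀ inside S. The extension only sees which
-- members of ℱ lie in S, so v̂(S) = v(S°). Moreover any two members of ℱ co-intersect,
-- through the top element ⋃ℱ, which has the least index. Hence (i) gives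
-- v̂(S) + v̂(T) = v(S°) + v(T°) ≤ v(S° ∧ T°) + v(S° ∨ T°) ≤ v̂(S ∩ T) + v̂(S ∪ T) by
-- monotonicity, and conversely (ii) applied to F, G yields F ∧ G := (F ∩ G)° and
-- F ∨ G := (F ∪ G)°.

open import Defs
open import Data.Nat using (ℕ; zero; suc)
open import Data.Bool using (true; false)
open import Data.Bool.Properties using (T-≡)
open import Data.Fin using (Fin; zero; suc) renaming (_≤_ to _≤ᶠ_)
open import Data.Fin.Subset using (Subset; _⊆_; _∪_; _∩_; ⊥; ⊤; Nonempty; _∈_)
open import Data.Fin.Subset.Properties
  using ( _⊆?_; nonempty?; ⊆-reflexive; ⊆-trans; ∉⊥; ⊥⊆; ∈⊤
        ; p⊆p∪q; q⊆p∪q; x∈p∪q⁻; x∈p∪q⁺; p∩q⊆p; p∩q⊆q; x∈p∩q⁺)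
open import Data.Vec using (_∷_; []; tabulate; here; there)
open import Data.Vec.Properties using ([]=⇒lookup; lookup⇒[]=; lookup∘tabulate)
open import Data.Maybe using (Maybe; just; nothing)
open import Data.Product using (∃; ∃₂; _×_; _,_; proj₂)
import Data.Sum as Sum
open import Data.Rational using (ℚ; 0ℚ; _+_; _≤_)
open import Data.Rational.Properties
  using (≤-refl; ≤-reflexive; +-comm; +-identityˡ; +-mono-≤; module ≤-Reasoning)
open import Relation.Nullary using (¬_; yes; no)
open import Relation.Nullary.Decidable using (⌊_⌋; toWitness; fromWitness)
open import Relation.Binary.PropositionalEquality using (_≡_; refl; sym; trans; cong; cong₂)
open import Data.Empty using (⊥-elim)
open import Function using (_∘_)
open import Function.Bundles using (_⇔_; mk⇔; Equivalence)

private
  variable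
    m n : ℕ

∪-mono-⊆ : {p p′ q q′ : Subset n} → p ⊆ p′ → q ⊆ q′ → p ∪ q ⊆ p′ ∪ q′
∪-mono-⊆ {p = p} {q = q} p⊆p′ q⊆q′ x∈p∪q = x∈p∪q⁺ (Sum.map p⊆p′ q⊆q′ (x∈p∪q⁻ p q x∈p∪q))

⊆-∩⁺ : {p q r : Subset n} → r ⊆ p → r ⊆ q → r ⊆ p ∩ q
⊆-∩⁺ r⊆p r⊆q x∈r = x∈p∩q⁺ (r⊆p x∈r , r⊆q x∈r)

⊆-unionOver : (F : Fin m → Subset n) {I : Subset m} {j : Fin m} → j ∈ I → F j ⊆ unionOver F I
⊆-unionOver F {true ∷ I}  here        = p⊆p∪q _
⊆-unionOver F {true ∷ I}  (there j∈I) = ⊆-trans (⊆-unionOver (F ∘ suc) j∈I) (q⊆p∪q (F zero) _)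
⊆-unionOver F {false ∷ I} (there j∈I) = ⊆-unionOver (F ∘ suc) j∈I

unionOver-least : (F : Fin m → Subset n) {I : Subset m} {S : Subset n} →
  (∀ {j} → j ∈ I → F j ⊆ S) → unionOver F I ⊆ S
unionOver-least {zero}  F {[]}        F⊆S x∈⊥ = ⊥-elim (∉⊥ x∈⊥)
unionOver-least {suc m} F {true ∷ I}  F⊆S x∈∪ with x∈p∪q⁻ (F zero) (unionOver (F ∘ suc) I) x∈∪
... | Sum.inj₁ x∈F₀ = F⊆S here x∈F₀
... | Sum.inj₂ x∈∪′ = unionOver-least (F ∘ suc) (F⊆S ∘ there) x∈∪′
unionOver-least {suc m} F {false ∷ I} F⊆S x∈∪ = unionOver-least (F ∘ suc) (F⊆S ∘ there) x∈∪

sumSub-cong : (F : Fin m → Subset n) (β : Fin m → ℚ) {S T : Subset n} →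
  (∀ j → F j ⊆ S → F j ⊆ T) → (∀ j → F j ⊆ T → F j ⊆ S) → sumSub F β S ≡ sumSub F β T
sumSub-cong {zero}  F β S⇒T T⇒S = refl
sumSub-cong {suc m} F β {S} {T} S⇒T T⇒S
  with F zero ⊆? S | F zero ⊆? T | sumSub-cong (F ∘ suc) (β ∘ suc) (S⇒T ∘ suc) (T⇒S ∘ suc)
... | yes _   | yes _   | rest = cong (β zero +_) rest
... | no _    | no _    | rest = cong (0ℚ +_) rest
... | yes F⊆S | no F⊈T  | _    = ⊥-elim (F⊈T (S⇒T zero F⊆S))
... | no F⊈S  | yes F⊆T | _    = ⊥-elim (F⊈S (T⇒S zero F⊆T))

sumSub-none : (F : Fin m → Subset n) (β : Fin m → ℚ) {S : Subset n} →
  (∀ j → ¬ F j ⊆ S) → sumSub F β S ≡ 0ℚ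
sumSub-none {zero}  F β F⊈S = refl
sumSub-none {suc m} F β {S} F⊈S with F zero ⊆? S
... | yes F⊆S = ⊥-elim (F⊈S zero F⊆S)
... | no _    = trans (cong (0ℚ +_) (sumSub-none (F ∘ suc) (β ∘ suc) (F⊈S ∘ suc))) (+-identityˡ 0ℚ)

indicesWithin : (Fin m → Subset n) → Subset n → Subset m
indicesWithin F S = tabulate (λ j → ⌊ F j ⊆? S ⌋)

∈-indicesWithin⁺ : (F : Fin m → Subset n) {S : Subset n} {j : Fin m} → F j ⊆ S → j ∈ indicesWithin F S
∈-indicesWithin⁺ F {S} {j} F⊆S =
  lookup⇒[]= j _ (trans (lookup∘tabulate _ j) (Equivalence.to T-≡ (fromWitness {a? = F j ⊆? S} F⊆S)))

∈-indicesWithin⁻ : (F : Fin m → Subset n) {S : Subset n} {j : Fin m} → j ∈ indicesWithin F S → F j ⊆ S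
∈-indicesWithin⁻ F {S} {j} j∈I =
  toWitness {a? = F j ⊆? S} (Equivalence.from T-≡ (trans (sym (lookup∘tabulate _ j)) ([]=⇒lookup j∈I)))

UnionClosed : (Fin m → Subset n) → Set
UnionClosed {m} F = ∀ (I : Subset m) → Nonempty I → ∃ λ k → F k ≡ unionOver F I

record IsInterior (F : Fin m → Subset n) (S : Subset n) (a : Maybe (Fin m)) : Set where
  constructor isInterior
  field
    contained : set₀ F a ⊆ S
    maximal   : ∀ j → F j ⊆ S → F j ⊆ set₀ F a
open IsInterior

interior : {F : Fin m → Subset n} → UnionClosed F → ∀ S → ∃ (IsInterior F S)
interior {F = F} closed S with nonempty? (indicesWithin F S)
... | no none = nothing , isInterior ⊥⊆ λ j F⊆S → ⊥-elim (none (j , ∈-indicesWithin⁺ F F⊆S))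
... | yes some with closed (indicesWithin F S) some
...   | k , k≡⋃ = just k , isInterior k⊆S k-maximal
  where
  k⊆S : F k ⊆ S
  k⊆S = ⊆-trans (⊆-reflexive k≡⋃) (unionOver-least F (∈-indicesWithin⁻ F))
  k-maximal : ∀ j → F j ⊆ S → F j ⊆ F k
  k-maximal j F⊆S = ⊆-trans (⊆-unionOver F (∈-indicesWithin⁺ F F⊆S)) (⊆-reflexive (sym k≡⋃))

interior-maximal : {F : Fin m → Subset n} {S : Subset n} {a : Maybe (Fin m)} →
  IsInterior F S a → ∀ b → set₀ F b ⊆ S → set₀ F b ⊆ set₀ F a
interior-maximal _     nothing  _   = ⊥⊆
interior-maximal a-int (just j) F⊆S = maximal a-int j F⊆S

extension-interior : {F : Fin m → Subset n} {v β : Fin m → ℚ} → IsExpansion F v β →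
  (∀ i → Nonempty (F i)) → {S : Subset n} {a : Maybe (Fin m)} →
  IsInterior F S a → extension F β S ≡ val₀ v a
extension-interior {F = F} {β = β} _ nonempty {a = nothing} a-int =
  sumSub-none F β λ j F⊆S → ∉⊥ (maximal a-int j F⊆S (proj₂ (nonempty j)))
extension-interior {F = F} {β = β} expansion _ {a = just k} k-int =
  trans (sumSub-cong F β (maximal k-int) (λ j F⊆k → ⊆-trans F⊆k (contained k-int))) (sym (expansion k))

val₀-mono : {F : Fin m → Subset n} {v : Fin m → ℚ} → IsCapacity F v → (∀ i → Nonempty (F i)) →
  ∀ a b → set₀ F a ⊆ set₀ F b → val₀ v a ≤ val₀ v b
val₀-mono capacity nonempty nothing  nothing  _   = ≤-refl
val₀-mono capacity nonempty nothing  (just j) _   = IsCapacity.nonneg capacity j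
val₀-mono capacity nonempty (just i) nothing  i⊆⊥ = ⊥-elim (∉⊥ (i⊆⊥ (proj₂ (nonempty i))))
val₀-mono capacity nonempty (just i) (just j) i⊆j = IsCapacity.monotone capacity i j i⊆j

coIntersecting-all : {F : Fin m → Subset n} → UnionClosed F → (∀ i → Nonempty (F i)) →
  (∀ i j → F j ⊆ F i → i ≤ᶠ j) → ∀ i j → CoIntersecting F i j
coIntersecting-all {F = F} closed nonempty indexing i j with closed ⊤ (i , ∈⊤)
... | k , k≡⋃ = k , indexing k i (below i) , indexing k j (below j) , meets i , meets j
  where
  below : ∀ l → F l ⊆ F k
  below l = ⊆-trans (⊆-unionOver F ∈⊤) (⊆-reflexive (sym k≡⋃))
  meets : ∀ l → Nonempty (F k ∩ F l)
  meets l with nonempty l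
  ... | x , x∈F = x , x∈p∩q⁺ (below l x∈F , x∈F)

-- (i) extended to ℱ₀, taking ∅ ∧ G = ∅ and ∅ ∨ G = G.
supermodular₀ : {F : Fin m → Subset n} {v : Fin m → ℚ} → (∀ i j → CoIntersecting F i j) →
  SupermodularOn F v → ∀ a b → ∃₂ λ c d →
    set₀ F c ⊆ set₀ F a × set₀ F c ⊆ set₀ F b × set₀ F d ⊆ set₀ F a ∪ set₀ F b ×
    val₀ v a + val₀ v b ≤ val₀ v c + val₀ v d
supermodular₀ coint sm nothing b = nothing , b , ⊥⊆ , ⊥⊆ , q⊆p∪q ⊥ _ , ≤-refl
supermodular₀ {v = v} coint sm (just i) nothing =
  nothing , just i , ⊥⊆ , ⊥⊆ , p⊆p∪q ⊥ , ≤-reflexive (+-comm (v i) 0ℚ)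
supermodular₀ coint sm (just i) (just j) with sm i j (coint i j)
... | c , d , _ , d⊆∪ , c⊆i , c⊆j , _ , _ , ineq = c , d , c⊆i , c⊆j , d⊆∪ , ineq

module _ {F : Fin m → Subset n} {v β : Fin m → ℚ}
         (family : IsFamily F) (capacity : IsCapacity F v) (expansion : IsExpansion F v β) where
  open IsFamily family
  open ≤-Reasoning

  v̂ : Subset n → ℚ
  v̂ = extension F β

  v̂-interior : ∀ {S a} → IsInterior F S a → v̂ S ≡ val₀ v a
  v̂-interior = extension-interior expansion nonempty

  val₀≤v̂ : ∀ a {S} → set₀ F a ⊆ S → val₀ v a ≤ v̂ S
  val₀≤v̂ a {S} a⊆S with interior unionClosed S
  ... | b , b-int = begin
    val₀ v a ≤⟨ val₀-mono capacity nonempty a b (interior-maximal b-int a a⊆S) ⟩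
    val₀ v b ≡⟨ sym (v̂-interior b-int) ⟩
    v̂ S      ∎

  supermodularOn⇒supermodularPowerset : SupermodularOn F v → SupermodularPowerset v̂
  supermodularOn⇒supermodularPowerset sm S T
    with interior unionClosed S | interior unionClosed T
  ... | a , a-int | b , b-int
    with supermodular₀ (coIntersecting-all unionClosed nonempty indexing) sm a b
  ... | c , d , c⊆a , c⊆b , d⊆a∪b , ineq = begin
    v̂ S + v̂ T                 ≡⟨ cong₂ _+_ (v̂-interior a-int) (v̂-interior b-int) ⟩
    val₀ v a + val₀ v b       ≤⟨ ineq ⟩
    val₀ v c + val₀ v d       ≤⟨ +-mono-≤ (val₀≤v̂ c c⊆S∩T) (val₀≤v̂ d d⊆S∪T) ⟩
    v̂ (S ∩ T) + v̂ (S ∪ T)     ≡⟨ +-comm (v̂ (S ∩ T)) (v̂ (S ∪ T)) ⟩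
    v̂ (S ∪ T) + v̂ (S ∩ T)     ∎
    where
    c⊆S∩T = ⊆-∩⁺ (⊆-trans c⊆a (contained a-int)) (⊆-trans c⊆b (contained b-int))
    d⊆S∪T = ⊆-trans d⊆a∪b (∪-mono-⊆ (contained a-int) (contained b-int))

  supermodularPowerset⇒supermodularOn : SupermodularPowerset v̂ → SupermodularOn F v
  supermodularPowerset⇒supermodularOn sp i j _
    with interior unionClosed (F i ∩ F j) | interior unionClosed (F i ∪ F j)
  ... | a , a-int | b , b-int =
    a , b , ⊆-trans a⊆∩ ∩⊆∪ , contained b-int
      , ⊆-trans a⊆∩ (p∩q⊆p (F i) (F j)) , ⊆-trans a⊆∩ (p∩q⊆q (F i) (F j))
      , maximal b-int i (p⊆p∪q (F j)) , maximal b-int j (q⊆p∪q (F i) (F j)) , ineq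
    where
    a⊆∩ : set₀ F a ⊆ F i ∩ F j
    a⊆∩ = contained a-int
    ∩⊆∪ : F i ∩ F j ⊆ F i ∪ F j
    ∩⊆∪ = ⊆-trans (p∩q⊆p (F i) (F j)) (p⊆p∪q (F j))
    ineq : v i + v j ≤ val₀ v a + val₀ v b
    ineq = begin
      v i + v j                     ≡⟨ cong₂ _+_ (expansion i) (expansion j) ⟩
      v̂ (F i) + v̂ (F j)             ≤⟨ sp (F i) (F j) ⟩
      v̂ (F i ∪ F j) + v̂ (F i ∩ F j) ≡⟨ +-comm (v̂ (F i ∪ F j)) (v̂ (F i ∩ F j)) ⟩
      v̂ (F i ∩ F j) + v̂ (F i ∪ F j) ≡⟨ cong₂ _+_ (v̂-interior a-int) (v̂-interior b-int) ⟩
      val₀ v a + val₀ v b           ∎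

corollary4 : ∀ {m n : ℕ} (F : Fin m → Subset n) (v β : Fin m → ℚ) →
    IsFamily F → IsCapacity F v → IsExpansion F v β →
    SupermodularOn F v ⇔ SupermodularPowerset (extension F β)
corollary4 F v β family capacity expansion =
  mk⇔ (supermodularOn⇒supermodularPowerset family capacity expansion)
      (supermodularPowerset⇒supermodularOn family capacity expansion)
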